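{- For $1 \leq i \leq s$ let $K_i$ be a simplicial complex that is nice on $[n_i]$, let $d_i=\dim(K_i)$, and set $d = \big( \sum_{i=1}^s d_i \big)+s-1 = \dim(K_1*K_2*\cdots*K_s)$. Suppose that $\big( \sum_{i=1}^s n_i \big)-s-2 = 2d$. Then $K_i = (\Delta_{2d_i+2})^{\leq d_i}$ for $1 \leq i \leq s$ (i.e., $n_i=2d_i+3$ and $K_i$ consists of all subsets of $[n_i]$ with at most $d_i+1$ elements), and therefore \[ \mathcal{F}_d = \Big\{(K_1*K_2*\cdots*K_s)^d\;\Big|\;s\ge1,\ K_i = (\Delta_{2d_i+2})^{\leq d_i},\ d_i\ge 0,\ \sum_{i=1}^s d_i =d -s +1\Big\}. \]
   Context: A simplicial complex $K$ with vertex set identified with a subset of $[n]$ is nice on $[n]$ if for every $F \subseteq [n]$ exactly one of $F$ and $[n]\setminus F$ belongs to $K$. The join $K_1*K_2$ has vertex set $V(K_1)\sqcup V(K_2)$ and simplices $F_1\sqcup F_2$ with $F_i\in K_i$. $\Delta_m^{\le j}$ is the complex of all subsets of size at most $j+1$ of an $(m+1)$-element set. For a $d$-dimensional complex $K$, $(K)^d$ denotes the $(d+1)$-graph (hypergraph with all edges of size $d+1$) on $V(K)$ whose edges are the $d$-simplices of $K$. For $d\ge1$, $\mathcal{F}_d$ is the family of all $(d+1)$-graphs $(K_1*\cdots*K_s)^d$ where $s\ge1$, each $K_i$ is nice on $[n_i]$, $\dim(K_1*\cdots*K_s)=d$ and $n_1+\dots+n_s=2d+s+2$. -}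

module Defs where

open import Level using (0ℓ)
open import Data.Nat as ℕ using (ℕ; zero; suc)
open import Data.Integer as ℤ using (ℤ; +_)
open import Data.Fin using (Fin) renaming (zero to fzero; suc to fsuc)
open import Data.Fin.Subset using (Subset; _⊆_; ∣_∣; ∁)
open import Data.Product using (Σ; _×_; ∃)
open import Data.Sum using (_⊎_)
open import Relation.Nullary using (¬_)
open import Relation.Binary.PropositionalEquality using (_≡_)

record SimplicialComplex (n : ℕ) : Set₁ where
  field
    face        : Subset n → Set
    down-closed : ∀ {F G : Subset n} → G ⊆ F → face F → face G
open SimplicialComplex public

Nice : ∀ {n} → SimplicialComplex n → Set
Nice {n} K = (F : Subset n) →
  (face K F × ¬ face K (∁ F)) ⊎ (¬ face K F × face K (∁ F))

-- dim K = d  (d : ℤ, so the complex {∅} has dimension -1):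
-- the maximum size of a face is d + 1.
HasDim : ∀ {n} → SimplicialComplex n → ℤ → Set
HasDim {n} K d =
  (Σ (Subset n) λ F → face K F × (+ ∣ F ∣) ≡ d ℤ.+ + 1) ×
  ((F : Subset n) → face K F → (+ ∣ F ∣) ℤ.≤ d ℤ.+ + 1)

IsSkeleton : ∀ {n} → SimplicialComplex n → ℤ → Set
IsSkeleton {n} K j = (F : Subset n) →
  (face K F → (+ ∣ F ∣) ℤ.≤ j ℤ.+ + 1) × ((+ ∣ F ∣) ℤ.≤ j ℤ.+ + 1 → face K F)

sumℕ : ∀ {s} → (Fin s → ℕ) → ℕ
sumℕ {zero}  f = 0
sumℕ {suc s} f = f fzero ℕ.+ sumℕ (λ i → f (fsuc i))

sumℤ : ∀ {s} → (Fin s → ℤ) → ℤ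
sumℤ {zero}  f = + 0
sumℤ {suc s} f = f fzero ℤ.+ sumℤ (λ i → f (fsuc i))

{-# OPTIONS --safe #-}
-- Let m be the size of a largest face of K (so m = dim K + 1).  Niceness forces n ≤ 2m + 1:
-- otherwise some F has |F| = m + 1 and |∁F| ≥ m + 1, and neither is a face.  Summed over i,
-- the hypothesis says these inequalities are all equalities.  Once n = 2m + 1, a set with at
-- most m elements has a complement with more than m elements, which is not a face, so by
-- niceness the set itself is a face: K is the full (m - 1)-skeleton.
module Submission where

open import Defs
open import Data.Nat using (ℕ)
open import Data.Integer using (ℤ; +_; _+_; _-_; _*_)
open import Data.Fin using (Fin)
open import Data.Product using (_×_)
open import Relation.Binary.PropositionalEquality using (_≡_)

open import Data.Nat as ℕ using (zero; suc; _≤_; _≤?_; z≤n; s≤s)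
import Data.Nat.Properties as ℕ
import Data.Integer as ℤ
import Data.Integer.Properties as ℤ
open import Data.Integer.Tactic.RingSolver using (solve-∀)
open import Data.Fin using () renaming (zero to fzero; suc to fsuc)
open import Data.Fin.Subset using (Subset; inside; outside; ⊥; ∁; ∣_∣)
open import Data.Fin.Subset.Properties using (∣⊥∣≡0)
open import Data.Vec using ([]; _∷_)
open import Data.Product using (_,_; proj₁; proj₂)
open import Data.Sum using (_⊎_; inj₁; inj₂)
open import Relation.Nullary using (yes; no; contradiction)
open import Function using (_∘_)
open import Relation.Binary.PropositionalEquality
  using (refl; sym; trans; cong; cong₂; subst; module ≡-Reasoning)

∣p∣+∣∁p∣≡n : ∀ {n} (p : Subset n) → ∣ p ∣ ℕ.+ ∣ ∁ p ∣ ≡ n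
∣p∣+∣∁p∣≡n         []            = refl
∣p∣+∣∁p∣≡n         (inside  ∷ p) = cong suc (∣p∣+∣∁p∣≡n p)
∣p∣+∣∁p∣≡n {suc n} (outside ∷ p) = trans (ℕ.+-suc ∣ p ∣ ∣ ∁ p ∣) (cong suc (∣p∣+∣∁p∣≡n p))

prefix : ∀ {n} → ℕ → Subset n
prefix {zero}  k       = []
prefix {suc n} zero    = ⊥
prefix {suc n} (suc k) = inside ∷ prefix k

∣prefix∣ : ∀ {n k} → k ≤ n → ∣ prefix {n} k ∣ ≡ k
∣prefix∣ {zero}  z≤n       = refl
∣prefix∣ {suc n} z≤n       = ∣⊥∣≡0 n
∣prefix∣ {suc n} (s≤s k≤n) = cong suc (∣prefix∣ k≤n)

FacesAtMost : ∀ {n} → SimplicialComplex n → ℕ → Set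
FacesAtMost {n} K m = (F : Subset n) → face K F → ∣ F ∣ ≤ m

module NiceWithSmallFaces {n} (K : SimplicialComplex n) (nice : Nice K) {m} (small : FacesAtMost K m) where

  small⊎∁small : (F : Subset n) → ∣ F ∣ ≤ m ⊎ ∣ ∁ F ∣ ≤ m
  small⊎∁small F with nice F
  ... | inj₁ (F∈K , _)  = inj₁ (small F F∈K)
  ... | inj₂ (_ , ∁F∈K) = inj₂ (small (∁ F) ∁F∈K)

  nice⇒n≤2m+1 : n ≤ suc (m ℕ.+ m)
  nice⇒n≤2m+1 with suc m ≤? n
  ... | no  m≮n = ℕ.≤-trans (ℕ.≮⇒≥ m≮n) (ℕ.m≤n⇒m≤1+n (ℕ.m≤m+n m m))
  ... | yes m<n with small⊎∁small (prefix (suc m))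
  ...   | inj₁ F≤m  = contradiction (subst (_≤ m) (∣prefix∣ m<n) F≤m) (ℕ.n≮n m)
  ...   | inj₂ ∁F≤m = subst (_≤ suc m ℕ.+ m) (∣p∣+∣∁p∣≡n F)
                        (ℕ.+-mono-≤ (ℕ.≤-reflexive (∣prefix∣ m<n)) ∁F≤m)
    where F = prefix (suc m)

  nice⇒skeleton : suc (m ℕ.+ m) ≤ n → (F : Subset n) → ∣ F ∣ ≤ m → face K F
  nice⇒skeleton 2m<n F F≤m with nice F
  ... | inj₁ (F∈K , _)  = F∈K
  ... | inj₂ (_ , ∁F∈K) = contradiction (subst (_≤ m ℕ.+ m) (∣p∣+∣∁p∣≡n F)
                            (ℕ.+-mono-≤ F≤m (small (∁ F) ∁F∈K))) (ℕ.<⇒≱ 2m<n)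

+-≤-≡⇒≡ : ∀ {a b c e} → a ≤ c → b ≤ e → a ℕ.+ b ≡ c ℕ.+ e → a ≡ c × b ≡ e
+-≤-≡⇒≡ {a} {b} {c} {e} a≤c b≤e sum≡ =
  a≡c , ℕ.+-cancelˡ-≡ a b e (trans sum≡ (cong (ℕ._+ e) (sym a≡c)))
  where
  a≡c : a ≡ c
  a≡c = ℕ.≤-antisym a≤c
          (ℕ.+-cancelʳ-≤ e c a (subst (_≤ a ℕ.+ e) sum≡ (ℕ.+-monoʳ-≤ a b≤e)))

sumℕ-mono-≤ : ∀ {s} {f g : Fin s → ℕ} → (∀ i → f i ≤ g i) → sumℕ f ≤ sumℕ g
sumℕ-mono-≤ {zero}  f≤g = z≤n
sumℕ-mono-≤ {suc s} f≤g = ℕ.+-mono-≤ (f≤g fzero) (sumℕ-mono-≤ (f≤g ∘ fsuc))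

sumℕ-≤-≡⇒≡ : ∀ {s} {f g : Fin s → ℕ} → (∀ i → f i ≤ g i) → sumℕ f ≡ sumℕ g → ∀ i → f i ≡ g i
sumℕ-≤-≡⇒≡ f≤g sum≡ fzero    = proj₁ (+-≤-≡⇒≡ (f≤g fzero) (sumℕ-mono-≤ (f≤g ∘ fsuc)) sum≡)
sumℕ-≤-≡⇒≡ f≤g sum≡ (fsuc i) =
  sumℕ-≤-≡⇒≡ (f≤g ∘ fsuc) (proj₂ (+-≤-≡⇒≡ (f≤g fzero) (sumℕ-mono-≤ (f≤g ∘ fsuc)) sum≡)) i

sumℤ-cong : ∀ {s} {f g : Fin s → ℤ} → (∀ i → f i ≡ g i) → sumℤ f ≡ sumℤ g
sumℤ-cong {zero}  f≡g = refl
sumℤ-cong {suc s} f≡g = cong₂ _+_ (f≡g fzero) (sumℤ-cong (f≡g ∘ fsuc))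

sumℤ-+ : ∀ {s} (f : Fin s → ℕ) → sumℤ (λ i → + f i) ≡ + sumℕ f
sumℤ-+ {zero}  f = refl
sumℤ-+ {suc s} f = cong (_+_ (+ f fzero)) (sumℤ-+ (f ∘ fsuc))

sumℤ-affine : ∀ {s} (a b : ℤ) (f : Fin s → ℤ) → sumℤ (λ i → a * f i + b) ≡ a * sumℤ f + b * + s
sumℤ-affine {zero}  a b f = base a b
  where
  base : ∀ a b → + 0 ≡ a * + 0 + b * + 0
  base = solve-∀
sumℤ-affine {suc s} a b f = begin
  (a * f fzero + b) + sumℤ (λ i → a * f (fsuc i) + b)
    ≡⟨ cong (_+_ (a * f fzero + b)) (sumℤ-affine a b (f ∘ fsuc)) ⟩
  (a * f fzero + b) + (a * sumℤ (f ∘ fsuc) + b * + s)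
    ≡⟨ step a b (f fzero) (sumℤ (f ∘ fsuc)) (+ s) ⟩
  a * (f fzero + sumℤ (f ∘ fsuc)) + b * (+ 1 + + s)
    ∎
  where
  open ≡-Reasoning
  step : ∀ a b x y t → (a * x + b) + (a * y + b * t) ≡ a * (x + y) + b * (+ 1 + t)
  step = solve-∀

x-t-2≡2[D+t-1]⇒x≡2D+3t : ∀ x D t → x - t - + 2 ≡ + 2 * (D + t - + 1) → x ≡ + 2 * D + + 3 * t
x-t-2≡2[D+t-1]⇒x≡2D+3t x D t eq = begin
  x                                ≡⟨ shift x t ⟩
  (x - t - + 2) + t + + 2          ≡⟨ cong (λ y → y + t + + 2) eq ⟩
  + 2 * (D + t - + 1) + t + + 2    ≡⟨ expand D t ⟩
  + 2 * D + + 3 * t                ∎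
  where
  open ≡-Reasoning
  shift : ∀ x t → x ≡ (x - t - + 2) + t + + 2
  shift = solve-∀
  expand : ∀ D t → + 2 * (D + t - + 1) + t + + 2 ≡ + 2 * D + + 3 * t
  expand = solve-∀

module Dimension {n} (K : SimplicialComplex n) (d : ℤ) (dim : HasDim K d) where

  maxFaceSize : ℕ
  maxFaceSize = ∣ proj₁ (proj₁ dim) ∣

  maxFaceSize≡d+1 : + maxFaceSize ≡ d + + 1
  maxFaceSize≡d+1 = proj₂ (proj₂ (proj₁ dim))

  ≤d+1⇒≤maxFaceSize : ∀ {k} → + k ℤ.≤ d + + 1 → k ≤ maxFaceSize
  ≤d+1⇒≤maxFaceSize k≤d+1 = ℤ.drop‿+≤+ (subst (+ _ ℤ.≤_) (sym maxFaceSize≡d+1) k≤d+1)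

  facesAtMost-maxFaceSize : FacesAtMost K maxFaceSize
  facesAtMost-maxFaceSize F F∈K = ≤d+1⇒≤maxFaceSize (proj₂ dim F F∈K)

  2maxFaceSize+1≡2d+3 : + suc (maxFaceSize ℕ.+ maxFaceSize) ≡ + 2 * d + + 3
  2maxFaceSize+1≡2d+3 = trans (cong (λ x → + 1 + (x + x)) maxFaceSize≡d+1) (double+1 d)
    where
    double+1 : ∀ x → + 1 + ((x + + 1) + (x + + 1)) ≡ + 2 * x + + 3
    double+1 = solve-∀

mainTheorem14 : (s : ℕ) (n : Fin s → ℕ) (K : (i : Fin s) → SimplicialComplex (n i))
    (d : Fin s → ℤ) →
    ((i : Fin s) → Nice (K i)) →
    ((i : Fin s) → HasDim (K i) (d i)) →
    ((+ sumℕ n) - (+ s) - + 2 ≡ + 2 * (sumℤ d + (+ s) - + 1)) →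
    (i : Fin s) → ((+ n i) ≡ + 2 * d i + + 3) × IsSkeleton (K i) (d i)
mainTheorem14 s n K d nice dim total i =
  trans (cong +_ (n≡2m+1 i)) (Dim.2maxFaceSize+1≡2d+3 i) ,
  λ F → proj₂ (dim i) F ,
        λ F≤d+1 → nice⇒skeleton (K i) (nice i) (small i) (ℕ.≤-reflexive (sym (n≡2m+1 i))) F
                    (Dim.≤d+1⇒≤maxFaceSize i F≤d+1)
  where
  open ≡-Reasoning
  open NiceWithSmallFaces
  module Dim (j : Fin s) = Dimension (K j) (d j) (dim j)

  m : Fin s → ℕ
  m = Dim.maxFaceSize

  small : ∀ j → FacesAtMost (K j) (m j)
  small = Dim.facesAtMost-maxFaceSize

  sumℕ-n≡sumℕ-2m+1 : sumℕ n ≡ sumℕ (λ j → suc (m j ℕ.+ m j))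
  sumℕ-n≡sumℕ-2m+1 = ℤ.+-injective (begin
    + sumℕ n                                ≡⟨ x-t-2≡2[D+t-1]⇒x≡2D+3t _ (sumℤ d) (+ s) total ⟩
    + 2 * sumℤ d + + 3 * + s                ≡⟨ sumℤ-affine (+ 2) (+ 3) d ⟨
    sumℤ (λ j → + 2 * d j + + 3)            ≡⟨ sumℤ-cong (sym ∘ Dim.2maxFaceSize+1≡2d+3) ⟩
    sumℤ (λ j → + suc (m j ℕ.+ m j))        ≡⟨ sumℤ-+ (λ j → suc (m j ℕ.+ m j)) ⟩
    + sumℕ (λ j → suc (m j ℕ.+ m j))        ∎)

  n≡2m+1 : ∀ j → n j ≡ suc (m j ℕ.+ m j)
  n≡2m+1 = sumℕ-≤-≡⇒≡ (λ j → nice⇒n≤2m+1 (K j) (nice j) (small j)) sumℕ-n≡sumℕ-2m+1
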